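{- Let $\pi$ be a noncrossing perfect matching and $p>0$ an integer. Then $A_\pi(-p)$ is an integer.
   Context: A matching of size $n$ is a set of $n$ disjoint pairs (arches) whose union is $\{1,\ldots,2n\}$, noncrossing: no two arches $\{i<j\}$, $\{k<l\}$ with $i<k<j<l$. For an integer $p\ge0$, $(\pi)_p$ is the matching of size $n+p$ with arches $\{i,2n+2p+1-i\}$ for $1\le i\le p$ and $\{i+p,j+p\}$ for $\{i,j\}\in\pi$ ($p$ nested arches added around $\pi$). Fully Packed Loops: take the $n\times n$ square grid graph together with $4n$ external edges, $n$ on each side (one per boundary vertex per side). Going around the boundary, every second external edge is selected, with the topmost external edge on the left side selected; the $2n$ selected edges are labeled $1,\ldots,2n$ counterclockwise. An FPL configuration of size $n$ is a set $F$ of edges consisting of all selected external edges, none of the other external edges, and some grid edges, such that each of the $n^2$ vertices has degree exactly $2$. The paths of $F$ connect the selected external edges in pairs, defining a matching $\pi(F)$. $A_\pi$ is the number of FPL configurations $F$ with $\pi(F)=\pi$. It is known that for each matching $\pi$ there is a unique polynomial $A_\pi(t)\in\mathbb{Q}[t]$ with $A_\pi(p)=A_{(\pi)_p}$ for all integers $p\ge0$; its degree is $d(\pi)=\sum_i(a_i-i)$, where $a_1<\cdots<a_n$ are the smaller elements of the arches of $\pi$. -}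

module Defs where

open import Data.Bool using (Bool; true; false; _∧_; not; _xor_; if_then_else_)
open import Data.Nat using (ℕ; zero; suc; _+_; _*_; _∸_; _<_; _≤_; _≡ᵇ_; _<?_; _%_; _/_)
open import Data.Fin using (Fin; fromℕ<)
open import Data.List using (List; []; _∷_; [_]; map; concatMap; cartesianProduct; filterᵇ; length; upTo)
open import Data.Bool.ListAction using (all)
open import Data.Maybe using (Maybe; just; nothing)
open import Data.Product using (_×_; _,_)
open import Data.Vec.Functional using () renaming (_∷_ to _◂_)
open import Data.Empty using (⊥)
open import Data.Integer using (ℤ)
open import Data.Rational using (ℚ; 0ℚ) renaming (_+_ to _+ℚ_; _*_ to _*ℚ_; _/_ to _/ℚ_)
open import Relation.Nullary using (yes; no; ¬_)
open import Relation.Binary.PropositionalEquality using (_≡_)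

-- A matching of size n is encoded as a function m : ℕ → ℕ,
-- where (0-indexed) point i < 2n is paired with m i.  Only the values on
-- {0,…,2n-1} matter.  (Label k in the paper is point k-1 here.)

IsPerfectMatching : ℕ → (ℕ → ℕ) → Set
IsPerfectMatching n m =
  ∀ i → i < 2 * n → (m i < 2 * n) × (¬ (m i ≡ i)) × (m (m i) ≡ i)

IsNoncrossing : ℕ → (ℕ → ℕ) → Set
IsNoncrossing n m =
  ∀ i k → i < 2 * n → k < 2 * n → i < k → k < m i → m i < m k → ⊥

IsNoncrossingPerfectMatching : ℕ → (ℕ → ℕ) → Set
IsNoncrossingPerfectMatching n m = IsPerfectMatching n m × IsNoncrossing n m

-- (π)_p : p nested arches around π; a matching of size n + p.
-- Point i (0-indexed) of (π)_p:  i < p  or  i ≥ 2n+p  ↦ 2n+2p-1-i,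
-- otherwise ↦ p + π(i - p).
nest : ℕ → ℕ → (ℕ → ℕ) → (ℕ → ℕ)
nest n p m i with i <? p | i <? 2 * n + p
... | yes _ | _     = 2 * n + 2 * p ∸ 1 ∸ i
... | no _  | yes _ = p + m (i ∸ p)
... | no _  | no _  = 2 * n + 2 * p ∸ 1 ∸ i

-- Vertices (r , c), 0 ≤ r,c < n, r = row (0 = top), c = column (0 = left).
-- H r c (r < n, c ≤ n): horizontal edge to the left of column c in row r
--   (c = 0 : left external edge, c = n : right external edge).
-- V r c (r ≤ n, c < n): vertical edge above row r in column c
--   (r = 0 : top external edge, r = n : bottom external edge).
-- A configuration is the set of edges whose indicator is true.

HEdges : ℕ → Set
HEdges n = Fin n → Fin (suc n) → Bool

VEdges : ℕ → Set
VEdges n = Fin (suc n) → Fin n → Bool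

funs : {A : Set} → (k : ℕ) → List A → List (Fin k → A)
funs zero    xs = [ (λ ()) ]
funs (suc k) xs = concatMap (λ x → map (λ f → x ◂ f) (funs k xs)) xs

bools : List Bool
bools = false ∷ true ∷ []

allEdgeSets : (n : ℕ) → List (HEdges n × VEdges n)
allEdgeSets n = cartesianProduct (funs n (funs (suc n) bools)) (funs (suc n) (funs n bools))

-- total ℕ-indexed access (false outside the range)
at : {k : ℕ} → (Fin k → Bool) → ℕ → Bool
at {k} f i with i <? k
... | yes p = f (fromℕ< p)
... | no _  = false

at₂ : {k l : ℕ} → (Fin k → Fin l → Bool) → ℕ → ℕ → Bool
at₂ {k} f i j with i <? k
... | yes p = at (f (fromℕ< p)) j
... | no _  = false

even : ℕ → Bool
even x = x % 2 ≡ᵇ 0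

_⇔ᵇ_ : Bool → Bool → Bool
a ⇔ᵇ b = not (a xor b)

boolToℕ : Bool → ℕ
boolToℕ true  = 1
boolToℕ false = 0

-- Boundary positions 0,…,4n-1 counterclockwise, starting at the topmost
-- left external edge:  left side row r ↦ r,  bottom side column c ↦ n + c,
-- right side row r ↦ 3n-1-r,  top side column c ↦ 4n-1-c.
-- Selected external edges = even positions; the selected edge at position
-- 2a carries (0-indexed) label a, i.e. paper label a+1.

IsFPL : (n : ℕ) → HEdges n → VEdges n → Bool
IsFPL n H V =
  all (λ r → (at₂ H r 0 ⇔ᵇ even r) ∧ (at₂ H r n ⇔ᵇ even (3 * n ∸ 1 ∸ r))) (upTo n)
  ∧ all (λ c → (at₂ V 0 c ⇔ᵇ even (4 * n ∸ 1 ∸ c)) ∧ (at₂ V n c ⇔ᵇ even (n + c))) (upTo n)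
  ∧ all (λ r → all (λ c →
        (boolToℕ (at₂ H r c) + boolToℕ (at₂ H r (suc c))
          + boolToℕ (at₂ V r c) + boolToℕ (at₂ V (suc r) c)) ≡ᵇ 2) (upTo n)) (upTo n)

data Dir : Set where
  L R U D : Dir

_≟D_ : Dir → Dir → Bool
L ≟D L = true
R ≟D R = true
U ≟D U = true
D ≟D D = true
_ ≟D _ = false

-- We stand at vertex (r , c) having
-- entered through the edge on side `from`; leave through the other edge of F
-- at this vertex.  Returns the (0-indexed) label of the external edge where
-- the path exits.  The fuel n*n+1 exceeds the number of vertices, so it never
-- runs out on a genuine FPL configuration.
module Follow (n : ℕ) (H : HEdges n) (V : VEdges n) where

  edge : ℕ → ℕ → Dir → Bool
  edge r c L = at₂ H r c
  edge r c R = at₂ H r (suc c)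
  edge r c U = at₂ V r c
  edge r c D = at₂ V (suc r) c

  out : ℕ → ℕ → Dir → Maybe Dir
  out r c from = pick (L ∷ R ∷ U ∷ D ∷ [])
    where
    pick : List Dir → Maybe Dir
    pick [] = nothing
    pick (d ∷ ds) = if (not (d ≟D from) ∧ edge r c d) then just d else pick ds

  go : ℕ → ℕ → ℕ → Dir → Maybe ℕ
  go zero r c from = nothing
  go (suc f) r c from with out r c from
  ... | nothing = nothing
  ... | just L = if c ≡ᵇ 0 then just (r / 2) else go f r (c ∸ 1) R
  ... | just R = if suc c ≡ᵇ n then just ((3 * n ∸ 1 ∸ r) / 2) else go f r (suc c) L
  ... | just U = if r ≡ᵇ 0 then just ((4 * n ∸ 1 ∸ c) / 2) else go f (r ∸ 1) c D
  ... | just D = if suc r ≡ᵇ n then just ((n + c) / 2) else go f (suc r) c U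

  fuel : ℕ
  fuel = suc (n * n)

  partner : ℕ → Maybe ℕ
  partner a with 2 * a <? n | 2 * a <? 2 * n | 2 * a <? 3 * n
  ... | yes _ | _     | _     = go fuel (2 * a) 0 L
  ... | no _  | yes _ | _     = go fuel (n ∸ 1) (2 * a ∸ n) D
  ... | no _  | no _  | yes _ = go fuel (3 * n ∸ 1 ∸ 2 * a) (n ∸ 1) R
  ... | no _  | no _  | no _  = go fuel 0 (4 * n ∸ 1 ∸ 2 * a) U

eqMaybeℕ : Maybe ℕ → Maybe ℕ → Bool
eqMaybeℕ (just x) (just y) = x ≡ᵇ y
eqMaybeℕ nothing  nothing  = true
eqMaybeℕ _        _        = false

HasMatching : (n : ℕ) → (ℕ → ℕ) → HEdges n → VEdges n → Bool
HasMatching n m H V = all (λ a → eqMaybeℕ (Follow.partner n H V a) (just (m a))) (upTo (2 * n))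

A : (n : ℕ) → (ℕ → ℕ) → ℕ
A n m = length (filterᵇ (λ { (H , V) → IsFPL n H V ∧ HasMatching n m H V }) (allEdgeSets n))

-- Polynomials over ℚ as coefficient lists (constant term first).

evalPoly : List ℚ → ℚ → ℚ
evalPoly []       x = 0ℚ
evalPoly (a ∷ as) x = a +ℚ (x *ℚ evalPoly as x)

ℤtoℚ : ℤ → ℚ
ℤtoℚ z = z /ℚ 1

-- A polynomial that takes integer values at all natural numbers also takes
-- integer values at all negative integers.  Applied to the polynomial A_π(t)
-- (whose values at t = q ≥ 0 are the FPL counts A_{(π)_q}) this gives the
-- integrality of A_π(-p); nothing about matchings or FPLs is needed.
--
-- The argument uses finite differences Δf(x) = f(x+1) - f(x).  We say f has
-- degree below k when Δᵏf vanishes identically, and check that this class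
-- contains constants, is closed under sums, shifts and multiplication by x
-- (raising the bound by one), hence contains evalPoly P with k = length P.
-- Integrality is then proved by induction on k: if f is integral on ℕ, so is
-- Δf, whose degree is lower, so Δf is integral on the negative integers as
-- well; and f(y) = f(y+1) - Δf(y) propagates integrality from f(0)
-- downwards through -1, -2, ….
module Submission where

open import Defs
open import Data.Nat using (ℕ; _>_; _+_)
open import Data.Integer using (ℤ; +_; -_)
open import Data.Rational using (ℚ)
open import Data.List using (List)
open import Data.Product using (∃)
open import Relation.Binary.PropositionalEquality using (_≡_)

import Data.Nat as ℕ
import Data.Nat.Properties as ℕP
import Data.Integer as ℤ
import Data.Integer.Properties as ℤP
import Data.Rational as ℚ
import Data.Rational.Properties as ℚP
import Data.Rational.Unnormalised as ℚᵘ
import Data.Rational.Unnormalised.Properties as ℚᵘP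
open import Data.Rational.Solver using (module +-*-Solver)
open import Data.List using ([]; _∷_; length)
open import Data.Product using (_,_)
open import Relation.Binary.PropositionalEquality using (refl; sym; trans; cong; cong₂)

open +-*-Solver

-- ℤtoℚ z is the normalisation of the unnormalised fraction z/1; equalities
-- are proved by passing through ℚᵘ, where z/1 is literally `ℤasℚᵘ z`.
ℤasℚᵘ : ℤ → ℚᵘ.ℚᵘ
ℤasℚᵘ z = ℚᵘ.mkℚᵘ z 0

ℤtoℚ-+ : ∀ a b → ℤtoℚ a ℚ.+ ℤtoℚ b ≡ ℤtoℚ (a ℤ.+ b)
ℤtoℚ-+ a b = ℚP.toℚᵘ-injective
  (ℚᵘP.≃-trans (ℚP.toℚᵘ-homo-+ (ℤtoℚ a) (ℤtoℚ b))
  (ℚᵘP.≃-trans (ℚᵘP.+-cong (ℚP.toℚᵘ-fromℚᵘ (ℤasℚᵘ a)) (ℚP.toℚᵘ-fromℚᵘ (ℤasℚᵘ b)))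
  (ℚᵘP.≃-trans sum/1 (ℚᵘP.≃-sym (ℚP.toℚᵘ-fromℚᵘ (ℤasℚᵘ (a ℤ.+ b)))))))
  where
  sum/1 : (ℤasℚᵘ a ℚᵘ.+ ℤasℚᵘ b) ℚᵘ.≃ ℤasℚᵘ (a ℤ.+ b)
  sum/1 = ℚᵘ.*≡* (cong (ℤ._* + 1) (cong₂ ℤ._+_ (ℤP.*-identityʳ a) (ℤP.*-identityʳ b)))

ℤtoℚ-neg : ∀ a → ℚ.- ℤtoℚ a ≡ ℤtoℚ (ℤ.- a)
ℤtoℚ-neg a = ℚP.toℚᵘ-injective
  (ℚᵘP.≃-trans (ℚP.toℚᵘ-homo‿- (ℤtoℚ a))
  (ℚᵘP.≃-trans (ℚᵘP.-‿cong (ℚP.toℚᵘ-fromℚᵘ (ℤasℚᵘ a)))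
  (ℚᵘP.≃-sym (ℚP.toℚᵘ-fromℚᵘ (ℤasℚᵘ (ℤ.- a))))))

ℤtoℚ-suc : ∀ q → ℤtoℚ (+ q) ℚ.+ ℚ.1ℚ ≡ ℤtoℚ (+ ℕ.suc q)
ℤtoℚ-suc q = trans (ℤtoℚ-+ (+ q) (+ 1)) (cong (λ n → ℤtoℚ (+ n)) (ℕP.+-comm q 1))

ℤtoℚ-negsuc : ∀ m → ℤtoℚ (ℤ.-[1+ m ]) ℚ.+ ℚ.1ℚ ≡ ℤtoℚ (- (+ m))
ℤtoℚ-negsuc m = trans (ℤtoℚ-+ ℤ.-[1+ m ] (+ 1)) (cong ℤtoℚ (-[1+m]+1 m))
  where
  -[1+m]+1 : ∀ m → ℤ.-[1+ m ] ℤ.+ + 1 ≡ - (+ m)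
  -[1+m]+1 ℕ.zero    = refl
  -[1+m]+1 (ℕ.suc m) = refl

IsInt : ℚ → Set
IsInt x = ∃ λ (z : ℤ) → x ≡ ℤtoℚ z

isInt-− : ∀ {x y} → IsInt x → IsInt y → IsInt (x ℚ.- y)
isInt-− (a , refl) (b , refl) =
  a ℤ.- b , trans (cong (ℤtoℚ a ℚ.+_) (ℤtoℚ-neg b)) (ℤtoℚ-+ a (ℤ.- b))

Δ : (ℚ → ℚ) → ℚ → ℚ
Δ f x = f (x ℚ.+ ℚ.1ℚ) ℚ.- f x

DegreeBelow : ℕ → (ℚ → ℚ) → Set
DegreeBelow ℕ.zero    f = ∀ x → f x ≡ ℚ.0ℚ
DegreeBelow (ℕ.suc k) f = DegreeBelow k (Δ f)

degree-ext : ∀ k f g → (∀ x → f x ≡ g x) → DegreeBelow k f → DegreeBelow k g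
degree-ext ℕ.zero    f g f≡g hf x = trans (sym (f≡g x)) (hf x)
degree-ext (ℕ.suc k) f g f≡g hf =
  degree-ext k (Δ f) (Δ g) (λ x → cong₂ ℚ._-_ (f≡g _) (f≡g x)) hf

degree-zero : ∀ k → DegreeBelow k (λ _ → ℚ.0ℚ)
degree-zero ℕ.zero    x = refl
degree-zero (ℕ.suc k) =
  degree-ext k (λ _ → ℚ.0ℚ) _ (λ _ → sym (ℚP.+-inverseʳ ℚ.0ℚ)) (degree-zero k)

degree-const : ∀ k c → DegreeBelow (ℕ.suc k) (λ _ → c)
degree-const k c = degree-ext k (λ _ → ℚ.0ℚ) _ (λ _ → sym (ℚP.+-inverseʳ c)) (degree-zero k)

degree-+ : ∀ k f g → DegreeBelow k f → DegreeBelow k g → DegreeBelow k (λ x → f x ℚ.+ g x)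
degree-+ ℕ.zero    f g hf hg x = cong₂ ℚ._+_ (hf x) (hg x)
degree-+ (ℕ.suc k) f g hf hg =
  degree-ext k (λ x → Δ f x ℚ.+ Δ g x) _ Δ-additive (degree-+ k (Δ f) (Δ g) hf hg)
  where
  Δ-additive : ∀ x → Δ f x ℚ.+ Δ g x ≡ Δ (λ y → f y ℚ.+ g y) x
  Δ-additive x = solve 4 (λ a b c d → (a :- c) :+ (b :- d) := (a :+ b) :- (c :+ d)) refl
                   (f (x ℚ.+ ℚ.1ℚ)) (g (x ℚ.+ ℚ.1ℚ)) (f x) (g x)

degree-shift : ∀ k f → DegreeBelow k f → DegreeBelow k (λ x → f (x ℚ.+ ℚ.1ℚ))
degree-shift ℕ.zero    f hf x = hf _
degree-shift (ℕ.suc k) f hf = degree-shift k (Δ f) hf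

-- Product rule Δ(x·f)(x) = x·Δf(x) + f(x+1): multiplying by x raises the
-- degree bound by one.
degree-x* : ∀ k f → DegreeBelow k f → DegreeBelow (ℕ.suc k) (λ x → x ℚ.* f x)
degree-x* ℕ.zero f hf x =
  trans (cong₂ (λ a b → (x ℚ.+ ℚ.1ℚ) ℚ.* a ℚ.- x ℚ.* b) (hf _) (hf x))
        (solve 1 (λ y → ((y :+ con ℚ.1ℚ) :* con ℚ.0ℚ) :- (y :* con ℚ.0ℚ) := con ℚ.0ℚ) refl x)
degree-x* (ℕ.suc k) f hf =
  degree-ext (ℕ.suc k) (λ x → x ℚ.* Δ f x ℚ.+ f (x ℚ.+ ℚ.1ℚ)) _ product-rule
    (degree-+ (ℕ.suc k) (λ x → x ℚ.* Δ f x) (λ x → f (x ℚ.+ ℚ.1ℚ))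
       (degree-x* k (Δ f) hf) (degree-shift (ℕ.suc k) f hf))
  where
  product-rule : ∀ x → x ℚ.* Δ f x ℚ.+ f (x ℚ.+ ℚ.1ℚ) ≡ Δ (λ y → y ℚ.* f y) x
  product-rule x =
    solve 3 (λ y a b → (y :* (a :- b)) :+ a := ((y :+ con ℚ.1ℚ) :* a) :- (y :* b)) refl
      x (f (x ℚ.+ ℚ.1ℚ)) (f x)

degree-evalPoly : ∀ P → DegreeBelow (length P) (evalPoly P)
degree-evalPoly []       x = refl
degree-evalPoly (a ∷ as) =
  degree-+ (ℕ.suc (length as)) (λ _ → a) (λ x → x ℚ.* evalPoly as x)
    (degree-const (length as) a)
    (degree-x* (length as) (evalPoly as) (degree-evalPoly as))

IntegralOnℕ : (ℚ → ℚ) → Set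
IntegralOnℕ f = ∀ q → IsInt (f (ℤtoℚ (+ q)))

IntegralOnℕ⁻ : (ℚ → ℚ) → Set
IntegralOnℕ⁻ f = ∀ m → IsInt (f (ℤtoℚ (- (+ m))))

Δ-integralOnℕ : ∀ f → IntegralOnℕ f → IntegralOnℕ (Δ f)
Δ-integralOnℕ f hf q with hf (ℕ.suc q)
... | z , fq+1≡z = isInt-− (z , trans (cong f (ℤtoℚ-suc q)) fq+1≡z) (hf q)

-- f(-m-1) = f(-m) - Δf(-m-1): integrality of f at 0 and of Δf at the
-- negative integers propagates to f at the negative integers.
integral-downwards : ∀ f → IsInt (f (ℤtoℚ (+ 0))) → IntegralOnℕ⁻ (Δ f) → IntegralOnℕ⁻ f
integral-downwards f hf0 hΔf ℕ.zero    = hf0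
integral-downwards f hf0 hΔf (ℕ.suc m)
  with integral-downwards f hf0 hΔf m | hΔf (ℕ.suc m)
... | a , f[-m]≡a | b , Δf[y]≡b =
  fromDifference (isInt-− (a , trans (cong f (ℤtoℚ-negsuc m)) f[-m]≡a) (b , Δf[y]≡b))
  where
  y : ℚ
  y = ℤtoℚ ℤ.-[1+ m ]
  fromDifference : IsInt (f (y ℚ.+ ℚ.1ℚ) ℚ.- Δ f y) → IsInt (f y)
  fromDifference (z , e) =
    z , trans (solve 2 (λ s t → t := s :- (s :- t)) refl (f (y ℚ.+ ℚ.1ℚ)) (f y)) e

integral-negatives : ∀ k f → DegreeBelow k f → IntegralOnℕ f → IntegralOnℕ⁻ f
integral-negatives ℕ.zero    f hf _    m = + 0 , hf _
integral-negatives (ℕ.suc k) f hf intf =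
  integral-downwards f (intf 0)
    (integral-negatives k (Δ f) hf (Δ-integralOnℕ f intf))

proposition3p6 : (n : ℕ) (π : ℕ → ℕ) → IsNoncrossingPerfectMatching n π →
    (P : List ℚ) → (∀ (q : ℕ) → evalPoly P (ℤtoℚ (+ q)) ≡ ℤtoℚ (+ A (n + q) (nest n q π))) →
    (p : ℕ) → p > 0 → ∃ λ (z : ℤ) → evalPoly P (ℤtoℚ (- (+ p))) ≡ ℤtoℚ z
proposition3p6 n π _ P P[q]≡A p _ =
  integral-negatives (length P) (evalPoly P) (degree-evalPoly P) integralOnℕ p
  where
  integralOnℕ : IntegralOnℕ (evalPoly P)
  integralOnℕ q = + A (n + q) (nest n q π) , P[q]≡A q
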